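{- Let $n\geq 4$, $\ell=n-3$, and let $(\mathbf d,\mathbf r)$ be an arithmetical structure on $D_n$. The following are equivalent: (a) $d_i\ge 2$ for all $i\in\{1,\dots,\ell\}$; (b) $r_0-r_1\ge r_1-r_2\ge\cdots\ge r_{\ell-1}-r_\ell>0$; (c) $r_0>r_1>\cdots>r_\ell$.
   Context: The bident $D_n$ ($n\ge3$, $\ell=n-3$) has vertices $v_x,v_y,v_0,\dots,v_\ell$ and edges $v_xv_0$, $v_yv_0$, $v_iv_{i+1}$ ($0\le i\le\ell-1$). An arithmetical structure on $D_n$ is a pair $(\mathbf d,\mathbf r)$, $\mathbf d=(d_x,d_y,d_0,\dots,d_\ell)$, $\mathbf r=(r_x,r_y,r_0,\dots,r_\ell)$, of positive integer vectors with $(\operatorname{diag}(\mathbf d)-A)\mathbf r=\mathbf 0$ ($A$ the adjacency matrix) and the entries of $\mathbf r$ having no nontrivial common factor. -}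

module Defs where

open import Data.Nat using (ℕ; zero; suc; _+_; _*_; _∸_; _≤_; _<_; _<?_)
open import Data.Nat.Divisibility using (_∣_)
open import Data.Fin using (Fin; toℕ; fromℕ<)
open import Data.List using (map; allFin)
open import Data.Nat.ListAction using (sum)
open import Data.Integer as ℤ using (ℤ; +_; _-_)
open import Data.Product using (_×_)
open import Relation.Nullary using (yes; no)
open import Relation.Binary.PropositionalEquality using (_≡_)

-- Vertex numbering of the bident D_n (vertex set Fin n):
--   0 ↦ v_x,  1 ↦ v_y,  2 + i ↦ v_i  (0 ≤ i ≤ ℓ = n - 3).

pathAdj : ℕ → ℕ → ℕ
pathAdj zero (suc zero) = 1
pathAdj (suc zero) zero = 1
pathAdj (suc a) (suc b) = pathAdj a b
pathAdj _ _ = 0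

adjℕ : ℕ → ℕ → ℕ
adjℕ 0 2 = 1
adjℕ 1 2 = 1
adjℕ 2 0 = 1
adjℕ 2 1 = 1
adjℕ (suc (suc a)) (suc (suc b)) = pathAdj a b
adjℕ _ _ = 0

A : (n : ℕ) → Fin n → Fin n → ℕ
A n u v = adjℕ (toℕ u) (toℕ v)

Aapply : (n : ℕ) → (Fin n → ℕ) → Fin n → ℕ
Aapply n r v = sum (map (λ u → A n v u * r u) (allFin n))

record IsArithmetical (n : ℕ) (d r : Fin n → ℕ) : Set where
  field
    d-pos : ∀ v → 1 ≤ d v
    r-pos : ∀ v → 1 ≤ r v
    eqn   : ∀ v → d v * r v ≡ Aapply n r v
    prim  : ∀ k → (∀ v → k ∣ r v) → k ≡ 1

-- value at vertex number k (0 outside the range; only used in range)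
at : {n : ℕ} → (Fin n → ℕ) → ℕ → ℕ
at {n} f k with k <? n
... | yes k<n = f (fromℕ< k<n)
... | no _ = 0

atP : {n : ℕ} → (Fin n → ℕ) → ℕ → ℕ
atP f i = at f (2 + i)

atPℤ : {n : ℕ} → (Fin n → ℕ) → ℕ → ℤ
atPℤ f i = + atP f i

CondA : (n : ℕ) → (Fin n → ℕ) → Set
CondA n d = ∀ i → 1 ≤ i → i ≤ n ∸ 3 → 2 ≤ atP d i

CondB : (n : ℕ) → (Fin n → ℕ) → Set
CondB n r =
  (∀ i → 1 ≤ i → i + 1 ≤ n ∸ 3 →
     (atPℤ r i - atPℤ r (i + 1)) ℤ.≤ (atPℤ r (i ∸ 1) - atPℤ r i))
  × (+ 0 ℤ.< (atPℤ r (n ∸ 3 ∸ 1) - atPℤ r (n ∸ 3)))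

CondC : (n : ℕ) → (Fin n → ℕ) → Set
CondC n r = ∀ i → i + 1 ≤ n ∸ 3 → atP r (i + 1) < atP r i

{-# OPTIONS --safe #-}
module Submission where

-- Only the equations at v_1, …, v_ℓ matter: d_i r_i = r_{i-1} + r_{i+1} for i < ℓ and
-- d_ℓ r_ℓ = r_{ℓ-1} at the leaf. Hence d_i ≥ 2 gives concavity 2 r_i ≤ r_{i-1} + r_{i+1},
-- and at the leaf 2 r_ℓ ≤ r_{ℓ-1}, so the last difference is positive. Nonincreasing
-- differences ending in a positive one are all positive, so r strictly decreases along the
-- leg. Finally r_i < r_{i-1} ≤ d_i r_i forces d_i ≥ 2.

open import Defs
open import Data.Nat
  using (ℕ; suc; _+_; _*_; _≤_; _<_; _≤‴_; ≤‴-refl; ≤‴-step; s≤s; s≤s⁻¹; z≤n; _<?_)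
open import Data.Nat.Properties
  using (+-comm; +-identityʳ; *-identityˡ; ≤-refl; ≤-reflexive; <⇒≤; m≤n⇒m≤1+n;
         m≤m+n; m<m+n; m≤n⇒m<n∨m≡n; ≤-<-trans; <-≤-trans; ≤⇒≤‴; ≤‴⇒≤;
         *-monoˡ-≤; *-cancelʳ-<; +-cancelʳ-<; +-monoʳ-<)
open import Data.Fin using (Fin; toℕ; fromℕ<)
open import Data.Fin.Properties using (toℕ<n; toℕ-fromℕ<; fromℕ<-toℕ; fromℕ<-cong)
open import Data.List using (map; tabulate)
open import Data.List.Properties using (map-tabulate; tabulate-cong)
open import Data.Nat.ListAction using (sum)
open import Data.Integer as ℤ using (ℤ; +_; 0ℤ; +≤+; +<+)
open import Data.Integer.Properties as ℤ
  using (i≤j⇒0≤j-i; 0≤i-j⇒j≤i; pos-+; drop‿+≤+; drop‿+<+; +-monoˡ-<)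
open import Data.Integer.Tactic.RingSolver using (solve-∀)
open import Data.Product using (_×_; _,_)
open import Data.Sum using (inj₁; inj₂)
open import Data.Empty using (⊥-elim)
open import Relation.Nullary using (yes; no)
open import Relation.Binary.PropositionalEquality
open import Function using (_∘_)
open import Function.Bundles using (_⇔_; mk⇔; module Equivalence)
import Function.Properties.Equivalence as ⇔

i-j≤k-l⇔i+l≤k+j : ∀ i j k l → (i ℤ.- j ℤ.≤ k ℤ.- l) ⇔ (i ℤ.+ l ℤ.≤ k ℤ.+ j)
i-j≤k-l⇔i+l≤k+j i j k l = mk⇔
  (λ h → 0≤i-j⇒j≤i (subst (0ℤ ℤ.≤_) (difference i j k l) (i≤j⇒0≤j-i h)))
  (λ h → 0≤i-j⇒j≤i (subst (0ℤ ℤ.≤_) (sym (difference i j k l)) (i≤j⇒0≤j-i h)))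
  where
  difference : ∀ i j k l → (k ℤ.- l) ℤ.- (i ℤ.- j) ≡ (k ℤ.+ j) ℤ.- (i ℤ.+ l)
  difference = solve-∀

0<i-j⇔j<i : ∀ i j → (0ℤ ℤ.< i ℤ.- j) ⇔ (j ℤ.< i)
0<i-j⇔j<i i j = mk⇔
  (λ h → subst₂ ℤ._<_ (ℤ.+-identityˡ j) (i-j+j≡i i j) (+-monoˡ-< j h))
  (λ h → subst (ℤ._< i ℤ.- j) (ℤ.+-inverseʳ j) (+-monoˡ-< (ℤ.- j) h))
  where
  i-j+j≡i : ∀ (i j : ℤ) → i ℤ.- j ℤ.+ j ≡ i
  i-j+j≡i = solve-∀

[+a]-[+b]≤[+c]-[+d]⇔a+d≤c+b : ∀ a b c d →
  (+ a ℤ.- + b ℤ.≤ + c ℤ.- + d) ⇔ (a + d ≤ c + b)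
[+a]-[+b]≤[+c]-[+d]⇔a+d≤c+b a b c d = mk⇔
  (λ h → drop‿+≤+ (subst₂ ℤ._≤_ (sym (pos-+ a d)) (sym (pos-+ c b)) (to h)))
  (λ h → from (subst₂ ℤ._≤_ (pos-+ a d) (pos-+ c b) (+≤+ h)))
  where open Equivalence (i-j≤k-l⇔i+l≤k+j (+ a) (+ b) (+ c) (+ d))

0<[+a]-[+b]⇔b<a : ∀ a b → (0ℤ ℤ.< + a ℤ.- + b) ⇔ (b < a)
0<[+a]-[+b]⇔b<a a b = mk⇔ (drop‿+<+ ∘ to) (from ∘ +<+)
  where open Equivalence (0<i-j⇔j<i (+ a) (+ b))


sumBelow : ℕ → (ℕ → ℕ) → ℕ
sumBelow n f = sum (tabulate {n = n} (f ∘ toℕ))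

sumBelow-zero : ∀ n → sumBelow n (λ _ → 0) ≡ 0
sumBelow-zero 0 = refl
sumBelow-zero (suc n) = sumBelow-zero n

sumBelow-pathAdj-inner : ∀ a m (g : ℕ → ℕ) → 2 + a < m →
  sumBelow m (λ j → pathAdj (suc a) j * g j) ≡ g a + g (2 + a)
sumBelow-pathAdj-inner 0 (suc (suc (suc m))) g _
  rewrite sumBelow-zero m | +-identityʳ (g 0) | +-identityʳ (g 2) | +-identityʳ (g 2) = refl
sumBelow-pathAdj-inner 0 1 g (s≤s ())
sumBelow-pathAdj-inner 0 2 g (s≤s (s≤s ()))
sumBelow-pathAdj-inner (suc a) (suc m) g (s≤s a<m) = sumBelow-pathAdj-inner a m (g ∘ suc) a<m

sumBelow-pathAdj-last : ∀ a (g : ℕ → ℕ) → sumBelow (2 + a) (λ j → pathAdj (suc a) j * g j) ≡ g a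
sumBelow-pathAdj-last 0 g = trans (+-identityʳ (g 0 + 0)) (+-identityʳ (g 0))
sumBelow-pathAdj-last (suc a) g = sumBelow-pathAdj-last a (g ∘ suc)


at-fromℕ< : ∀ {n} (f : Fin n → ℕ) {k} (k<n : k < n) → at f k ≡ f (fromℕ< k<n)
at-fromℕ< {n} f {k} k<n with k <? n
... | yes k<n′ = cong f (fromℕ<-cong k k refl k<n′ k<n)
... | no k≮n = ⊥-elim (k≮n k<n)

at-toℕ : ∀ {n} (f : Fin n → ℕ) (u : Fin n) → at f (toℕ u) ≡ f u
at-toℕ f u = trans (at-fromℕ< f (toℕ<n u)) (cong f (fromℕ<-toℕ u (toℕ<n u)))

Aapply≡sumBelow : ∀ n (r : Fin n → ℕ) v →
  Aapply n r v ≡ sumBelow n (λ j → adjℕ (toℕ v) j * at r j)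
Aapply≡sumBelow n r v = begin
  sum (map (λ u → A n v u * r u) (tabulate (λ u → u)))
    ≡⟨ cong sum (map-tabulate (λ u → u) (λ u → A n v u * r u)) ⟩
  sum (tabulate (λ u → A n v u * r u))
    ≡⟨ cong sum (tabulate-cong (λ u → cong (A n v u *_) (sym (at-toℕ r u)))) ⟩
  sumBelow n (λ j → adjℕ (toℕ v) j * at r j) ∎
  where open ≡-Reasoning

-- D and p are d and r read along the leg v_0, …, v_{k+1}, so ℓ = k + 1; of the positivity
-- of r only r_ℓ > 0 is needed.
record IsPendantPath (k : ℕ) (D p : ℕ → ℕ) : Set where
  field
    leaf-pos : 1 ≤ p (suc k)
    inner    : ∀ {i} → i < k → D (suc i) * p (suc i) ≡ p i + p (2 + i)
    leaf     : D (suc k) * p (suc k) ≡ p k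

module _ {k : ℕ} {d r : Fin (4 + k) → ℕ} (H : IsArithmetical (4 + k) d r) where
  open IsArithmetical H

  pathVertex-eqn : ∀ {i} → i ≤ suc k →
    atP d i * atP r i ≡ sumBelow (4 + k) (λ j → adjℕ (2 + i) j * at r j)
  pathVertex-eqn {i} i≤1+k = begin
    atP d i * atP r i        ≡⟨ cong₂ _*_ (at-fromℕ< d v<n) (at-fromℕ< r v<n) ⟩
    d v * r v                ≡⟨ eqn v ⟩
    Aapply (4 + k) r v       ≡⟨ Aapply≡sumBelow (4 + k) r v ⟩
    sumBelow (4 + k) (λ j → adjℕ (toℕ v) j * at r j)
      ≡⟨ cong (λ t → sumBelow (4 + k) (λ j → adjℕ t j * at r j)) (toℕ-fromℕ< v<n) ⟩
    sumBelow (4 + k) (λ j → adjℕ (2 + i) j * at r j) ∎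
    where
    open ≡-Reasoning
    v<n : 2 + i < 4 + k
    v<n = s≤s (s≤s (s≤s i≤1+k))
    v : Fin (4 + k)
    v = fromℕ< v<n

  arithmetical⇒isPendantPath : IsPendantPath k (atP d) (atP r)
  arithmetical⇒isPendantPath = record
    { leaf-pos = subst (1 ≤_) (sym (at-fromℕ< r ≤-refl)) (r-pos _)
    ; inner    = λ {i} i<k → trans (pathVertex-eqn {suc i} (m≤n⇒m≤1+n i<k))
                                   (sumBelow-pathAdj-inner i (2 + k) (atP r) (s≤s (s≤s i<k)))
    ; leaf     = trans (pathVertex-eqn ≤-refl) (sumBelow-pathAdj-last k (atP r))
    }


AtLeastTwo : ℕ → (ℕ → ℕ) → Set
AtLeastTwo k D = ∀ {i} → i ≤ k → 2 ≤ D (suc i)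

Concave : ℕ → (ℕ → ℕ) → Set
Concave k p = ∀ {i} → i < k → p (suc i) + p (suc i) ≤ p i + p (2 + i)

ConcaveDescent : ℕ → (ℕ → ℕ) → Set
ConcaveDescent k p = Concave k p × p (suc k) < p k

StrictlyDecreasing : ℕ → (ℕ → ℕ) → Set
StrictlyDecreasing k p = ∀ {i} → i ≤ k → p (suc i) < p i

2≤m⇒n+n≤m*n : ∀ {m} n → 2 ≤ m → n + n ≤ m * n
2≤m⇒n+n≤m*n {m} n 2≤m = subst (_≤ m * n) (cong (_+_ n) (+-identityʳ n)) (*-monoˡ-≤ n 2≤m)

n<m*n⇒2≤m : ∀ {m n} → n < m * n → 2 ≤ m
n<m*n⇒2≤m {m} {n} n<m*n = *-cancelʳ-< n 1 m (subst (_< m * n) (sym (*-identityˡ n)) n<m*n)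

n+n≤m+o⇒o<n⇒n<m : ∀ {m n o} → n + n ≤ m + o → o < n → n < m
n+n≤m+o⇒o<n⇒n<m {m} {n} {o} n+n≤m+o o<n =
  +-cancelʳ-< n n m (≤-<-trans n+n≤m+o (+-monoʳ-< m o<n))

module _ {k : ℕ} {D p : ℕ → ℕ} (P : IsPendantPath k D p) where
  open IsPendantPath P

  atLeastTwo⇒concaveDescent : AtLeastTwo k D → ConcaveDescent k p
  atLeastTwo⇒concaveDescent two =
      (λ {i} i<k → subst (p (suc i) + p (suc i) ≤_) (inner i<k) (2≤m⇒n+n≤m*n _ (two (<⇒≤ i<k))))
    , subst (p (suc k) <_) leaf (<-≤-trans (m<m+n _ leaf-pos) (2≤m⇒n+n≤m*n _ (two ≤-refl)))

  concaveDescent⇒strictlyDecreasing : ConcaveDescent k p → StrictlyDecreasing k p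
  concaveDescent⇒strictlyDecreasing (concave , lastStep) = descend ∘ ≤⇒≤‴
    where
    descend : ∀ {i} → i ≤‴ k → p (suc i) < p i
    descend ≤‴-refl        = lastStep
    descend (≤‴-step i<k) = n+n≤m+o⇒o<n⇒n<m (concave (≤‴⇒≤ i<k)) (descend i<k)

  p[i]≤D[1+i]*p[1+i] : ∀ {i} → i ≤ k → p i ≤ D (suc i) * p (suc i)
  p[i]≤D[1+i]*p[1+i] {i} i≤k with m≤n⇒m<n∨m≡n i≤k
  ... | inj₁ i<k = subst (p i ≤_) (sym (inner i<k)) (m≤m+n (p i) _)
  ... | inj₂ refl = ≤-reflexive (sym leaf)

  strictlyDecreasing⇒atLeastTwo : StrictlyDecreasing k p → AtLeastTwo k D
  strictlyDecreasing⇒atLeastTwo decreasing i≤k =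
    n<m*n⇒2≤m (<-≤-trans (decreasing i≤k) (p[i]≤D[1+i]*p[1+i] i≤k))

  atLeastTwo⇔concaveDescent : AtLeastTwo k D ⇔ ConcaveDescent k p
  atLeastTwo⇔concaveDescent = mk⇔ atLeastTwo⇒concaveDescent
    (strictlyDecreasing⇒atLeastTwo ∘ concaveDescent⇒strictlyDecreasing)

  concaveDescent⇔strictlyDecreasing : ConcaveDescent k p ⇔ StrictlyDecreasing k p
  concaveDescent⇔strictlyDecreasing = mk⇔ concaveDescent⇒strictlyDecreasing
    (atLeastTwo⇒concaveDescent ∘ strictlyDecreasing⇒atLeastTwo)


i+1≤n⇔i<n : ∀ i n → (i + 1 ≤ n) ⇔ (i < n)
i+1≤n⇔i<n i n rewrite +-comm i 1 = mk⇔ (λ h → h) (λ h → h)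

condA⇔atLeastTwo : ∀ k (d : Fin (4 + k) → ℕ) → CondA (4 + k) d ⇔ AtLeastTwo k (atP d)
condA⇔atLeastTwo k d = mk⇔ (λ two {i} i≤k → two (suc i) (s≤s z≤n) (s≤s i≤k)) fromAtLeastTwo
  where
  fromAtLeastTwo : AtLeastTwo k (atP d) → CondA (4 + k) d
  fromAtLeastTwo two (suc i) _ (s≤s i≤k) = two i≤k

concaveAtℤ⇔concaveAt : ∀ {n} (r : Fin n → ℕ) i →
  (atPℤ r (suc i) ℤ.- atPℤ r (suc i + 1) ℤ.≤ atPℤ r i ℤ.- atPℤ r (suc i))
    ⇔ (atP r (suc i) + atP r (suc i) ≤ atP r i + atP r (2 + i))
concaveAtℤ⇔concaveAt r i rewrite +-comm i 1 =
  [+a]-[+b]≤[+c]-[+d]⇔a+d≤c+b (atP r (suc i)) (atP r (2 + i)) (atP r i) (atP r (suc i))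

condB⇔concaveDescent : ∀ k (r : Fin (4 + k) → ℕ) → CondB (4 + k) r ⇔ ConcaveDescent k (atP r)
condB⇔concaveDescent k r = mk⇔ toConcaveDescent fromConcaveDescent
  where
  toConcaveDescent : CondB (4 + k) r → ConcaveDescent k (atP r)
  toConcaveDescent (concave , lastStep) =
      (λ {i} i<k → Equivalence.to (concaveAtℤ⇔concaveAt r i)
         (concave (suc i) (s≤s z≤n) (Equivalence.from (i+1≤n⇔i<n (suc i) (suc k)) (s≤s i<k))))
    , Equivalence.to (0<[+a]-[+b]⇔b<a (atP r k) (atP r (suc k))) lastStep

  fromConcaveDescent : ConcaveDescent k (atP r) → CondB (4 + k) r
  fromConcaveDescent (concave , lastStep) =
      (λ { (suc i) _ i+2≤k+1 → Equivalence.from (concaveAtℤ⇔concaveAt r i)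
             (concave (s≤s⁻¹ (Equivalence.to (i+1≤n⇔i<n (suc i) (suc k)) i+2≤k+1))) })
    , Equivalence.from (0<[+a]-[+b]⇔b<a (atP r k) (atP r (suc k))) lastStep

condC⇔strictlyDecreasing : ∀ k (r : Fin (4 + k) → ℕ) → CondC (4 + k) r ⇔ StrictlyDecreasing k (atP r)
condC⇔strictlyDecreasing k r = mk⇔
  (λ decreasing {i} i≤k → subst (λ j → atP r j < atP r i) (+-comm i 1)
     (decreasing i (Equivalence.from (i+1≤n⇔i<n i (suc k)) (s≤s i≤k))))
  (λ decreasing i i+1≤k+1 → subst (λ j → atP r j < atP r i) (+-comm 1 i)
     (decreasing (s≤s⁻¹ (Equivalence.to (i+1≤n⇔i<n i (suc k)) i+1≤k+1))))

lemma2p1 : (n : ℕ) → 4 ≤ n → (d r : Fin n → ℕ) → IsArithmetical n d r →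
    (CondA n d ⇔ CondB n r) × (CondB n r ⇔ CondC n r)
lemma2p1 (suc (suc (suc (suc k)))) (s≤s (s≤s (s≤s (s≤s _)))) d r H =
    ⇔.trans (condA⇔atLeastTwo k d)
      (⇔.trans (atLeastTwo⇔concaveDescent leg) (⇔.sym (condB⇔concaveDescent k r)))
  , ⇔.trans (condB⇔concaveDescent k r)
      (⇔.trans (concaveDescent⇔strictlyDecreasing leg) (⇔.sym (condC⇔strictlyDecreasing k r)))
  where
  leg : IsPendantPath k (atP d) (atP r)
  leg = arithmetical⇒isPendantPath H
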